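{- Let $\mathbf A=(A,\wedge,\vee,\to,t,N,f)$ be an algebra such that $(A,\wedge,\vee,\to,t)$ is a relative Stone algebra, $N$ is a nucleus on it, $f\in A$, and for all $a\in A$: $a\vee(a\to f)=t$, $N(Na\to a)=t$, and $Na=t\iff f\le a$. Then $Na=f\to a$ for all $a\in A$.
   Context: A Brouwerian algebra is $(A,\wedge,\vee,\to,t)$ with $(A,\wedge,\vee)$ a lattice with top $t$ and $a\wedge b\le c\iff a\le b\to c$; a relative Stone algebra is a Brouwerian algebra satisfying $(a\to b)\vee(b\to a)=t$. A nucleus on it is a closure operator $N$ (isotone, $a\le Na$, $NNa=Na$) with $Na\wedge Nb\le N(a\wedge b)$. -}

module Defs where

open import Level using (Level; _⊔_) 
open import Function.Bundles using (_⇔_)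
open import Relation.Binary.Core using (Rel)
open import Relation.Binary.Definitions using (Maximum)
open import Relation.Binary.PropositionalEquality using (_≡_)
open import Relation.Binary.Lattice.Structures using (IsLattice)
open import Algebra.Core using (Op₂; Op₁)

record IsBrouwerian {a ℓ : Level} {A : Set a} (_≤_ : Rel A ℓ)
         (_∧_ _∨_ _⇒_ : Op₂ A) (t : A) : Set (a ⊔ ℓ) where
  field
    isLattice   : IsLattice _≡_ _≤_ _∨_ _∧_
    maximum     : Maximum _≤_ t
    residuation : ∀ x y z → ((x ∧ y) ≤ z) ⇔ (x ≤ (y ⇒ z))

record IsRelativeStone {a ℓ : Level} {A : Set a} (_≤_ : Rel A ℓ)
         (_∧_ _∨_ _⇒_ : Op₂ A) (t : A) : Set (a ⊔ ℓ) where
  field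
    isBrouwerian : IsBrouwerian _≤_ _∧_ _∨_ _⇒_ t
    prelinear    : ∀ x y → ((x ⇒ y) ∨ (y ⇒ x)) ≡ t

record IsNucleus {a ℓ : Level} {A : Set a} (_≤_ : Rel A ℓ)
         (_∧_ : Op₂ A) (N : Op₁ A) : Set (a ⊔ ℓ) where
  field
    isotone     : ∀ {x y} → x ≤ y → N x ≤ N y
    extensive   : ∀ x → x ≤ N x
    idempotent  : ∀ x → N (N x) ≡ N x
    meet-preserving : ∀ x y → (N x ∧ N y) ≤ N (x ∧ y)

-- The two inequalities are obtained separately, and each needs only a
-- small part of the hypotheses:
--
--  * f → x ≤ N x holds in any Brouwerian algebra with a nucleus N
--    satisfying N f = t: since f → x ≤ N (f → x) ∧ N f ≤ N ((f → x) ∧ f)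
--    and (f → x) ∧ f ≤ x  (modus ponens).
--  * N x ≤ f → x holds in any Brouwerian algebra as soon as
--    f ≤ N x → x, by exchanging the premises of a residual.
--
-- The hypothesis N a = t ⇔ f ≤ a supplies both premises: N f = t since
-- f ≤ f, and f ≤ N x → x since N (N x → x) = t.  Antisymmetry concludes.
module Submission where

open import Defs
open import Level using (Level)
open import Relation.Binary.Core using (Rel)
open import Relation.Binary.PropositionalEquality using (_≡_; subst; sym)
open import Function.Bundles using (_⇔_; Equivalence)
open import Algebra.Core using (Op₂; Op₁)
open import Relation.Binary.Lattice.Structures using (IsLattice)

open Equivalence using (to; from)

module BrouwerianProperties
    {a ℓ : Level} {A : Set a} {_≤_ : Rel A ℓ}
    {_∧_ _∨_ _⇒_ : Op₂ A} {t : A}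
    (isBrouwerian : IsBrouwerian _≤_ _∧_ _∨_ _⇒_ t) where

  open IsBrouwerian isBrouwerian
  open IsLattice isLattice

  ∧-swap : ∀ x y → (x ∧ y) ≤ (y ∧ x)
  ∧-swap x y = ∧-greatest (x∧y≤y x y) (x∧y≤x x y)

  modus-ponens : ∀ y z → ((y ⇒ z) ∧ y) ≤ z
  modus-ponens y z = from (residuation (y ⇒ z) y z) refl

  exchange : ∀ {x y z} → x ≤ (y ⇒ z) → y ≤ (x ⇒ z)
  exchange {x} {y} {z} x≤y⇒z =
    to (residuation y x z) (trans (∧-swap y x) (from (residuation x y z) x≤y⇒z))

module NucleusProperties
    {a ℓ : Level} {A : Set a} {_≤_ : Rel A ℓ}
    {_∧_ _∨_ _⇒_ : Op₂ A} {t : A} {N : Op₁ A}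
    (isBrouwerian : IsBrouwerian _≤_ _∧_ _∨_ _⇒_ t)
    (isNucleus : IsNucleus _≤_ _∧_ N) where

  open IsBrouwerian isBrouwerian
  open IsLattice isLattice
  open IsNucleus isNucleus
  open BrouwerianProperties isBrouwerian using (modus-ponens)

  below-dense : ∀ {y} → N y ≡ t → ∀ x → x ≤ N y
  below-dense {y} Ny≡t x = subst (x ≤_) (sym Ny≡t) (maximum x)

  -- If N f = t then f → x ≤ N x, via
  -- f → x ≤ N (f → x) ∧ N f ≤ N ((f → x) ∧ f) ≤ N x.
  residual≤nucleus : ∀ {f} → N f ≡ t → ∀ x → (f ⇒ x) ≤ N x
  residual≤nucleus {f} Nf≡t x =
    trans (extensive (f ⇒ x))
      (trans (∧-greatest refl (below-dense Nf≡t (N (f ⇒ x))))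
        (trans (meet-preserving (f ⇒ x) f)
          (isotone (modus-ponens f x))))

mainTheorem6 : {a ℓ : Level} {A : Set a} (_≤_ : Rel A ℓ)
    (_∧_ _∨_ _⇒_ : Op₂ A) (t : A) (N : Op₁ A) (f : A) →
    IsRelativeStone _≤_ _∧_ _∨_ _⇒_ t →
    IsNucleus _≤_ _∧_ N →
    (∀ x → (x ∨ (x ⇒ f)) ≡ t) →
    (∀ x → N (N x ⇒ x) ≡ t) →
    (∀ x → (N x ≡ t) ⇔ (f ≤ x)) →
    ∀ x → N x ≡ (f ⇒ x)
mainTheorem6 _≤_ _∧_ _∨_ _⇒_ t N f isRelativeStone isNucleus _
             N[Nx⇒x]≡t Nx≡t⇔f≤x x =
  antisym Nx≤f⇒x f⇒x≤Nx
  where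
  open IsRelativeStone isRelativeStone using (isBrouwerian)
  open IsBrouwerian isBrouwerian using (isLattice)
  open IsLattice isLattice using (antisym; refl)
  open BrouwerianProperties isBrouwerian using (exchange)
  open NucleusProperties isBrouwerian isNucleus using (residual≤nucleus)

  Nf≡t : N f ≡ t
  Nf≡t = from (Nx≡t⇔f≤x f) refl

  f≤Nx⇒x : f ≤ (N x ⇒ x)
  f≤Nx⇒x = to (Nx≡t⇔f≤x (N x ⇒ x)) (N[Nx⇒x]≡t x)

  Nx≤f⇒x : N x ≤ (f ⇒ x)
  Nx≤f⇒x = exchange f≤Nx⇒x

  f⇒x≤Nx : (f ⇒ x) ≤ N x
  f⇒x≤Nx = residual≤nucleus Nf≡t x
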